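{- Let $G_1=(V_1,E_1)$ and $G_2=(V_2,E_2)$ be graphs. Then $f(G_1\ltimes G_2)\leq f(G_1)|V_2|$ for each $f\in\{\mathrm{thin},\mathrm{pthin},\mathrm{compthin},\mathrm{comppthin},\mathrm{indthin},\mathrm{indpthin}\}$.
   Context: Graphs are finite, simple, undirected (loopless). The homomorphic product $G_1\ltimes G_2$ has vertex set $V_1\times V_2$, and distinct vertices $(u_1,u_2)$, $(v_1,v_2)$ are adjacent iff either $u_1=v_1$, or ($u_1v_1\in E_1$ and $u_2v_2\notin E_2$). For a graph $G=(V,E)$, an ordering $v_1,\dots,v_n$ of $V$ and a partition of $V$ are consistent if for every $r<s<t$, whenever $v_r,v_s$ are in the same class and $v_tv_r\in E$, then $v_tv_s\in E$; strongly consistent if moreover for every $r<s<t$, whenever $v_s,v_t$ are in the same class and $v_tv_r\in E$, then $v_sv_r\in E$. $\mathrm{thin}(G)$ (resp. $\mathrm{pthin}(G)$) is the minimum number of classes of a partition of $V$ consistent (resp. strongly consistent) with some ordering of $V$. $\mathrm{indthin}$, $\mathrm{indpthin}$ are defined likewise requiring each class to be an independent set, and $\mathrm{compthin}$, $\mathrm{comppthin}$ requiring each class to be a clique. -}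

module Defs where

open import Data.Nat using (ℕ; _*_)
open import Data.Fin using (Fin; quotient; remainder)
open import Data.Fin.Base using ()
open import Data.Product using (Σ; _×_; _,_)
open import Data.Sum using (_⊎_)
open import Relation.Nullary using (¬_; Dec)
open import Relation.Binary.PropositionalEquality using (_≡_; _≢_)
open import Function.Definitions using (Injective)
import Data.Fin as F

record Graph : Set₁ where
  field
    n     : ℕ
    E     : Fin n → Fin n → Set
    irrefl : ∀ u → ¬ E u u
    sym   : ∀ u v → E u v → E v u
    dec   : ∀ u v → Dec (E u v)
open Graph public

-- Homomorphic product G₁ ⋉ G₂ on V₁ × V₂, encoded as Fin (n₁ * n₂):
-- a vertex x corresponds to the pair (quotient n₂ x , remainder n₂ x).
_⋉_ : Graph → Graph → Graph
G₁ ⋉ G₂ = record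
  { n = N
  ; E = Adj
  ; irrefl = λ u (u≢u , _) → u≢u _≡_.refl
  ; sym = symm
  ; dec = decide
  }
  where
  open import Relation.Binary.PropositionalEquality as Eq using ()
  open import Relation.Nullary using (yes; no)
  open import Relation.Nullary.Decidable using (_×-dec_; _⊎-dec_; ¬?)
  N : ℕ
  N = n G₁ * n G₂
  q : Fin N → Fin (n G₁)
  q = quotient (n G₂)
  r : Fin N → Fin (n G₂)
  r = remainder {n G₁} (n G₂)
  Adj : Fin N → Fin N → Set
  Adj x y = x ≢ y × (q x ≡ q y ⊎ (E G₁ (q x) (q y) × ¬ E G₂ (r x) (r y)))
  symm : ∀ x y → Adj x y → Adj y x
  symm x y (x≢y , _⊎_.inj₁ e) = (λ e' → x≢y (Eq.sym e')) , _⊎_.inj₁ (Eq.sym e)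
  symm x y (x≢y , _⊎_.inj₂ (e₁ , ne₂)) =
    (λ e' → x≢y (Eq.sym e')) , _⊎_.inj₂ (sym G₁ _ _ e₁ , λ e₂ → ne₂ (sym G₂ _ _ e₂))
  decide : ∀ x y → Dec (Adj x y)
  decide x y = ¬? (x F.≟ y) ×-dec ((q x F.≟ q y) ⊎-dec (dec G₁ (q x) (q y) ×-dec ¬? (dec G₂ (r x) (r y))))

-- An ordering of V(G) is given by an injective position map pos : Fin n → Fin n
-- (v comes before w iff pos v < pos w); a partition into at most m classes is
-- given by a class map cls : Fin n → Fin m.
module _ (G : Graph) (pos : Fin (n G) → Fin (n G)) {m : ℕ} (cls : Fin (n G) → Fin m) where

  Consistent : Set
  Consistent = ∀ r s t → pos r F.< pos s → pos s F.< pos t →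
               cls r ≡ cls s → E G t r → E G t s

  StronglyConsistent : Set
  StronglyConsistent = Consistent ×
    (∀ r s t → pos r F.< pos s → pos s F.< pos t →
               cls s ≡ cls t → E G t r → E G s r)

  ClassesIndependent : Set
  ClassesIndependent = ∀ u v → cls u ≡ cls v → ¬ E G u v

  ClassesCliques : Set
  ClassesCliques = ∀ u v → u ≢ v → cls u ≡ cls v → E G u v

data Param : Set where
  thin pthin compthin comppthin indthin indpthin : Param

Valid : Param → (G : Graph) → (Fin (n G) → Fin (n G)) → {m : ℕ} → (Fin (n G) → Fin m) → Set
Valid thin      G pos cls = Consistent G pos cls
Valid pthin     G pos cls = StronglyConsistent G pos cls
Valid compthin  G pos cls = Consistent G pos cls × ClassesCliques G pos cls
Valid comppthin G pos cls = StronglyConsistent G pos cls × ClassesCliques G pos cls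
Valid indthin   G pos cls = Consistent G pos cls × ClassesIndependent G pos cls
Valid indpthin  G pos cls = StronglyConsistent G pos cls × ClassesIndependent G pos cls

-- f(G) ≤ m : there is an ordering of V(G) and a partition of V(G) into at most m
-- classes (class map into Fin m; empty classes allowed) that is valid for f.
_≤[_]_ : Graph → Param → ℕ → Set
G ≤[ f ] m = Σ (Fin (n G) → Fin (n G)) λ pos → Injective _≡_ _≡_ pos ×
             Σ (Fin (n G) → Fin m) λ cls → Valid f G pos cls

module Submission where

-- Identify a vertex x of G₁ ⋉ G₂ with its coordinates
-- (π₁ x , π₂ x) ∈ V₁ × V₂.  Given an ordering pos₁ of V₁ and a partition
-- cls₁ of V₁ into k classes that is valid for f, order V₁ × V₂
-- lexicographically, (pos₁ (π₁ x) , π₂ x), and put x into the class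
-- (cls₁ (π₁ x) , π₂ x); both pairs are encoded with  combine, giving
-- k * |V₂| classes.
--
-- Two facts about the lexicographic order drive everything: two vertices
-- in one class share their second coordinate, so if they are ordered then
-- their first coordinates are strictly ordered by pos₁; and an edge between
-- vertices whose first coordinates differ is an edge of G₁ together with a
-- non-edge of G₂.  Hence every consistency condition in the product either
-- holds inside a fibre {u} × V₂ (a clique) or reduces to the same condition
-- in G₁.  Cliques and independent classes are preserved likewise, so the
-- lifted ordering/partition is valid for each of the six parameters.

open import Defs
open import Data.Nat using (ℕ; _*_)
import Data.Nat as Nat
import Data.Nat.Properties as NatP
open import Data.Fin using (Fin; quotient; remainder; combine; toℕ; _<_)
open import Data.Fin.Properties
  using (combine-remQuot; combine-injective; combine-monoˡ-<; toℕ-combine; <-cmp; <⇒≢; <-trans; <-irrefl; _≟_)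
open import Data.Product using (_×_; _,_)
open import Data.Sum using (_⊎_; inj₁; inj₂)
open import Data.Empty using (⊥-elim)
open import Relation.Nullary using (¬_; yes; no)
open import Relation.Binary using (tri<; tri≈; tri>)
open import Relation.Binary.PropositionalEquality
  using (_≡_; _≢_; refl; trans; cong; cong₂; subst; subst₂)
  renaming (sym to ≡-sym)
open import Function.Definitions using (Injective)

combine-<-lex : ∀ {m n} (i i′ : Fin m) (j j′ : Fin n) →
                combine i j < combine i′ j′ → i < i′ ⊎ (i ≡ i′ × j < j′)
combine-<-lex {n = n} i i′ j j′ lt with <-cmp i i′
... | tri< i<i′ _ _ = inj₁ i<i′
... | tri≈ _ refl _ = inj₂ (refl , NatP.+-cancelˡ-< (n * toℕ i) (toℕ j) (toℕ j′)
        (subst₂ Nat._<_ (toℕ-combine i j) (toℕ-combine i j′) lt))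
... | tri> _ _ i′<i = ⊥-elim (NatP.<-asym lt (combine-monoˡ-< j′ j i′<i))

combine-<-sameʳ : ∀ {m n} (i i′ : Fin m) (j j′ : Fin n) →
                  j ≡ j′ → combine i j < combine i′ j′ → i < i′
combine-<-sameʳ i i′ j j′ j≡j′ lt with combine-<-lex i i′ j j′ lt
... | inj₁ i<i′ = i<i′
... | inj₂ (_ , j<j′) = ⊥-elim (<-irrefl j≡j′ j<j′)

module Lift (G₁ G₂ : Graph) {k : ℕ}
            (pos₁ : Fin (n G₁) → Fin (n G₁)) (pos₁-inj : Injective _≡_ _≡_ pos₁)
            (cls₁ : Fin (n G₁) → Fin k) where

  P : Graph
  P = G₁ ⋉ G₂

  V : Set
  V = Fin (n G₁ * n G₂)

  π₁ : V → Fin (n G₁)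
  π₁ = quotient (n G₂)

  π₂ : V → Fin (n G₂)
  π₂ = remainder {n G₁} (n G₂)

  coords-injective : ∀ x y → π₁ x ≡ π₁ y → π₂ x ≡ π₂ y → x ≡ y
  coords-injective x y e₁ e₂ = trans (≡-sym (combine-remQuot {n G₁} (n G₂) x))
    (trans (cong₂ combine e₁ e₂) (combine-remQuot {n G₁} (n G₂) y))

  pos : V → V
  pos x = combine (pos₁ (π₁ x)) (π₂ x)

  cls : V → Fin (k * n G₂)
  cls x = combine (cls₁ (π₁ x)) (π₂ x)

  pos-injective : Injective _≡_ _≡_ pos
  pos-injective {x} {y} e with combine-injective (pos₁ (π₁ x)) (π₂ x) (pos₁ (π₁ y)) (π₂ y) e
  ... | e₁ , e₂ = coords-injective x y (pos₁-inj e₁) e₂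

  cls-coords : ∀ x y → cls x ≡ cls y → cls₁ (π₁ x) ≡ cls₁ (π₁ y) × π₂ x ≡ π₂ y
  cls-coords x y = combine-injective _ _ _ _

  before⇒≢ : ∀ x y → pos x < pos y → y ≢ x
  before⇒≢ x y lt y≡x = <⇒≢ lt (cong pos (≡-sym y≡x))

  later-fibre : ∀ x y → pos x < pos y → π₁ x ≡ π₁ y ⊎ pos₁ (π₁ x) < pos₁ (π₁ y)
  later-fibre x y lt with combine-<-lex (pos₁ (π₁ x)) (pos₁ (π₁ y)) (π₂ x) (π₂ y) lt
  ... | inj₁ lt₁ = inj₂ lt₁
  ... | inj₂ (e , _) = inj₁ (pos₁-inj e)

  same-π₂-before : ∀ x y → π₂ x ≡ π₂ y → pos x < pos y → pos₁ (π₁ x) < pos₁ (π₁ y)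
  same-π₂-before x y = combine-<-sameʳ (pos₁ (π₁ x)) (pos₁ (π₁ y)) (π₂ x) (π₂ y)

  fibre-adjacent : ∀ x y → x ≢ y → π₁ x ≡ π₁ y → E P x y
  fibre-adjacent x y x≢y e = x≢y , inj₁ e

  lifted-adjacent : ∀ x y → x ≢ y → E G₁ (π₁ x) (π₁ y) → ¬ E G₂ (π₂ x) (π₂ y) → E P x y
  lifted-adjacent x y x≢y e₁ ¬e₂ = x≢y , inj₂ (e₁ , ¬e₂)

  cross-edge : ∀ x y → pos₁ (π₁ x) < pos₁ (π₁ y) → E P y x →
               E G₁ (π₁ y) (π₁ x) × ¬ E G₂ (π₂ y) (π₂ x)
  cross-edge x y lt (_ , inj₁ e) = ⊥-elim (<⇒≢ lt (cong pos₁ (≡-sym e)))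
  cross-edge x y lt (_ , inj₂ edge) = edge

  consistent : Consistent G₁ pos₁ cls₁ → Consistent P pos cls
  consistent cons₁ a b c a<b b<c ab-class c~a
    with cls-coords a b ab-class | later-fibre b c b<c
  ... | _ , _ | inj₁ πb≡πc = fibre-adjacent c b (before⇒≢ b c b<c) (≡-sym πb≡πc)
  ... | class₁ , πa≡πb | inj₂ b<₁c
    with cross-edge a c (<-trans (same-π₂-before a b πa≡πb a<b) b<₁c) c~a
  ... | e₁ , ¬e₂ =
    lifted-adjacent c b (before⇒≢ b c b<c)
      (cons₁ (π₁ a) (π₁ b) (π₁ c) (same-π₂-before a b πa≡πb a<b) b<₁c class₁ e₁)
      (λ e₂ → ¬e₂ (subst (E G₂ (π₂ c)) (≡-sym πa≡πb) e₂))

  strongly-consistent : StronglyConsistent G₁ pos₁ cls₁ → StronglyConsistent P pos cls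
  strongly-consistent (cons₁ , strong₁) = consistent cons₁ , strong
    where
    strong : ∀ a b c → pos a < pos b → pos b < pos c → cls b ≡ cls c → E P c a → E P b a
    strong a b c a<b b<c bc-class c~a
      with cls-coords b c bc-class | later-fibre a b a<b
    ... | _ , _ | inj₁ πa≡πb = fibre-adjacent b a (before⇒≢ a b a<b) (≡-sym πa≡πb)
    ... | class₁ , πb≡πc | inj₂ a<₁b
      with cross-edge a c (<-trans a<₁b (same-π₂-before b c πb≡πc b<c)) c~a
    ... | e₁ , ¬e₂ =
      lifted-adjacent b a (before⇒≢ a b a<b)
        (strong₁ (π₁ a) (π₁ b) (π₁ c) a<₁b (same-π₂-before b c πb≡πc b<c) class₁ e₁)
        (λ e₂ → ¬e₂ (subst (λ j → E G₂ j (π₂ a)) πb≡πc e₂))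

  -- A product class is a G₁-class times a single G₂-vertex, so it is a clique
  -- when the G₁-classes are (within a fibre every pair is adjacent anyway).
  cliques : ClassesCliques G₁ pos₁ cls₁ → ClassesCliques P pos cls
  cliques cliques₁ x y x≢y xy-class with cls-coords x y xy-class | π₁ x ≟ π₁ y
  ... | _ , _ | yes e = fibre-adjacent x y x≢y e
  ... | class₁ , πx≡πy | no π₁x≢π₁y =
    lifted-adjacent x y x≢y (cliques₁ (π₁ x) (π₁ y) π₁x≢π₁y class₁)
      (λ e₂ → irrefl G₂ (π₂ y) (subst (λ j → E G₂ j (π₂ y)) πx≡πy e₂))

  -- Two distinct vertices of one product class lie in different fibres,
  -- so an edge between them would be an edge inside a G₁-class.
  independent : ClassesIndependent G₁ pos₁ cls₁ → ClassesIndependent P pos cls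
  independent indep₁ x y xy-class (x≢y , edge) with cls-coords x y xy-class | edge
  ... | _ , πx≡πy | inj₁ e = x≢y (coords-injective x y e πx≡πy)
  ... | class₁ , _ | inj₂ (e₁ , _) = indep₁ (π₁ x) (π₁ y) class₁ e₁

  valid : ∀ f → Valid f G₁ pos₁ cls₁ → Valid f P pos cls
  valid thin      c       = consistent c
  valid pthin     s       = strongly-consistent s
  valid compthin  (c , w) = consistent c , cliques w
  valid comppthin (s , w) = strongly-consistent s , cliques w
  valid indthin   (c , w) = consistent c , independent w
  valid indpthin  (s , w) = strongly-consistent s , independent w

theorem4p49 : (f : Param) (G₁ G₂ : Graph) (k : ℕ) →
              G₁ ≤[ f ] k → (G₁ ⋉ G₂) ≤[ f ] (k * n G₂)
theorem4p49 f G₁ G₂ k (pos₁ , pos₁-inj , cls₁ , valid₁) =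
  pos , pos-injective , cls , valid f valid₁
  where open Lift G₁ G₂ pos₁ pos₁-inj cls₁
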